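{- Let $T$ be a Frobenius monad on a dagger category $\mathcal{C}$, and let $U\colon\mathcal{C}^T\to\mathcal{C}$ be the forgetful functor. Then the FEM-algebras form the largest full subcategory of $\mathcal{C}^T$ containing (the image of) $\mathcal{C}_T$ that carries a dagger commuting with $U$: that is, the full subcategory of FEM-algebras contains all free algebras $(T(A),\mu_A)$ and carries such a dagger, and every full subcategory of $\mathcal{C}^T$ containing all free algebras and carrying a dagger $\ddagger$ with $U(f^\ddagger)=U(f)^\dagger$ consists only of FEM-algebras.
   Context: A dagger category has an identity-on-objects contravariant functor $f\mapsto f^\dagger$ with $f^{\dagger\dagger}=f$. A Frobenius monad is a monad $(T,\mu,\eta)$ on $\mathcal{C}$ with $T(f^\dagger)=T(f)^\dagger$ for all $f$ and $T(\mu_A)\circ\mu^\dagger_{T(A)}=\mu_{T(A)}\circ T(\mu_A^\dagger)$ for all $A$. $\mathcal{C}^T$ is the category of Eilenberg–Moore algebras: objects $(A,a)$ with $a\colon T(A)\to A$, $a\circ T(a)=a\circ\mu_A$, $a\circ\eta_A=\mathrm{id}_A$; morphisms $f\colon(A,a)\to(B,b)$ are $f\colon A\to B$ with $b\circ T(f)=f\circ a$; $U(A,a)=A$, $U(f)=f$. The Kleisli category $\mathcal{C}_T$ is identified with the full subcategory of free algebras $(T(A),\mu_A)$. A FEM-algebra is an Eilenberg–Moore algebra $(A,a)$ with $\mu_A\circ T(a)^\dagger=T(a)\circ\mu_A^\dagger$. -}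

module Defs where

open import Level using (Level; _⊔_) renaming (suc to lsuc)
open import Relation.Binary.PropositionalEquality using (_≡_; refl; trans; sym; cong)
open import Data.Product using (_×_)

record Category (o ℓ : Level) : Set (lsuc (o ⊔ ℓ)) where
  infixr 9 _∘_
  field
    Obj : Set o
    Hom : Obj → Obj → Set ℓ
    id  : ∀ {A} → Hom A A
    _∘_ : ∀ {A B C} → Hom B C → Hom A B → Hom A C
    identityˡ : ∀ {A B} (f : Hom A B) → id ∘ f ≡ f
    identityʳ : ∀ {A B} (f : Hom A B) → f ∘ id ≡ f
    assoc : ∀ {A B C D} (f : Hom A B) (g : Hom B C) (h : Hom C D) →
            (h ∘ g) ∘ f ≡ h ∘ (g ∘ f)

record DaggerCategory (o ℓ : Level) : Set (lsuc (o ⊔ ℓ)) where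
  field
    cat : Category o ℓ
  open Category cat public
  field
    _† : ∀ {A B} → Hom A B → Hom B A
    †-id : ∀ {A} → (id {A}) † ≡ id
    †-∘ : ∀ {A B C} (f : Hom A B) (g : Hom B C) → (g ∘ f) † ≡ (f †) ∘ (g †)
    †-involutive : ∀ {A B} (f : Hom A B) → (f †) † ≡ f

record Monad {o ℓ : Level} (C : Category o ℓ) : Set (o ⊔ ℓ) where
  open Category C
  field
    T₀ : Obj → Obj
    T₁ : ∀ {A B} → Hom A B → Hom (T₀ A) (T₀ B)
    T-id : ∀ {A} → T₁ (id {A}) ≡ id
    T-∘ : ∀ {A B C} (f : Hom A B) (g : Hom B C) → T₁ (g ∘ f) ≡ T₁ g ∘ T₁ f
    η : ∀ A → Hom A (T₀ A)
    μ : ∀ A → Hom (T₀ (T₀ A)) (T₀ A)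
    η-natural : ∀ {A B} (f : Hom A B) → η B ∘ f ≡ T₁ f ∘ η A
    μ-natural : ∀ {A B} (f : Hom A B) → μ B ∘ T₁ (T₁ f) ≡ T₁ f ∘ μ A
    μ-assoc : ∀ A → μ A ∘ T₁ (μ A) ≡ μ A ∘ μ (T₀ A)
    μ-unitˡ : ∀ A → μ A ∘ η (T₀ A) ≡ id
    μ-unitʳ : ∀ A → μ A ∘ T₁ (η A) ≡ id

module _ {o ℓ : Level} (D : DaggerCategory o ℓ) where
  open DaggerCategory D

  record FrobeniusMonad : Set (o ⊔ ℓ) where
    field
      monad : Monad cat
    open Monad monad public
    field
      T-† : ∀ {A B} (f : Hom A B) → T₁ (f †) ≡ (T₁ f) †
      frobenius : ∀ A → T₁ (μ A) ∘ (μ (T₀ A)) † ≡ μ (T₀ A) ∘ T₁ ((μ A) †)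

module EM {o ℓ : Level} {D : DaggerCategory o ℓ} (F : FrobeniusMonad D) where
  open DaggerCategory D
  open FrobeniusMonad F

  record Alg : Set (o ⊔ ℓ) where
    constructor alg
    field
      carrier : Obj
      action  : Hom (T₀ carrier) carrier
      act-μ   : action ∘ T₁ action ≡ action ∘ μ carrier
      act-η   : action ∘ η carrier ≡ id
  open Alg public

  record AlgHom (X Y : Alg) : Set ℓ where
    constructor alghom
    field
      map : Hom (carrier X) (carrier Y)
      commutes : action Y ∘ T₁ map ≡ map ∘ action X
  open AlgHom public

  U₀ : Alg → Obj
  U₀ = carrier

  U₁ : ∀ {X Y} → AlgHom X Y → Hom (U₀ X) (U₀ Y)
  U₁ = map

  -- Free algebra (T A, μ_A): the image of the Kleisli category in C^T.
  free : Obj → Alg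
  free A = alg (T₀ A) (μ A) (μ-assoc A) (μ-unitˡ A)

  IsFEM : Alg → Set ℓ
  IsFEM X = μ (carrier X) ∘ (T₁ (action X)) † ≡ T₁ (action X) ∘ (μ (carrier X)) †

  idAlg : ∀ X → AlgHom X X
  idAlg X = alghom id (trans (trans (cong (action X ∘_) T-id) (identityʳ _)) (sym (identityˡ _)))

  -- A dagger ‡ on the full subcategory of C^T spanned by the algebras
  -- satisfying P, commuting with U (U(f‡) = U(f)†).  Equality of algebra
  -- morphisms is equality of underlying morphisms (U is faithful).
  record DaggerOverU {p : Level} (P : Alg → Set p) : Set (o ⊔ ℓ ⊔ p) where
    field
      _‡ : ∀ {X Y} → P X → P Y → AlgHom X Y → AlgHom Y X
      ‡-U : ∀ {X Y} (pX : P X) (pY : P Y) (f : AlgHom X Y) →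
            U₁ (_‡ pX pY f) ≡ (U₁ f) †
      ‡-id : ∀ {X} (pX : P X) →
             U₁ (_‡ pX pX (idAlg _)) ≡ id
      ‡-∘ : ∀ {X Y Z} (pX : P X) (pY : P Y) (pZ : P Z)
            (f : AlgHom X Y) (g : AlgHom Y Z) (gf : AlgHom X Z) →
            U₁ gf ≡ U₁ g ∘ U₁ f →
            U₁ (_‡ pX pZ gf) ≡ U₁ (_‡ pX pY f) ∘ U₁ (_‡ pY pZ g)
      ‡-involutive : ∀ {X Y} (pX : P X) (pY : P Y) (f : AlgHom X Y) →
            U₁ (_‡ pY pX (_‡ pX pY f)) ≡ U₁ f

-- The dagger of a natural transformation is natural, so ν = μ† ∘ η is
-- natural. The FEM law rewrites a† as T(a) ∘ ν for an algebra (A, a), and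
-- naturality of ν then shows that f† is an algebra morphism whenever f is one
-- between FEM-algebras. Conversely, if a dagger over U exists on a full
-- subcategory containing the free algebras, then a† = U((a : (TA, μ) → (A, a))‡)
-- is an algebra morphism, i.e. μ ∘ T(a†) = a† ∘ a. The right-hand side is
-- self-adjoint, hence so is μ ∘ T(a†), and that is precisely the FEM law.
module Submission where

open import Defs
open import Level using (Level)
open import Data.Product using (_×_; _,_)
open import Relation.Binary.PropositionalEquality

module CategoryProperties {o ℓ : Level} (C : Category o ℓ) where
  open Category C
  open ≡-Reasoning

  square-paste : ∀ {A B C′ A′ B′ C″} {g : Hom A B} {f : Hom B C′} {g′ : Hom A′ B′}
                 {f′ : Hom B′ C″} {h : Hom A A′} {k : Hom B B′} {l : Hom C′ C″} →
                 l ∘ f ≡ f′ ∘ k → k ∘ g ≡ g′ ∘ h → l ∘ (f ∘ g) ≡ (f′ ∘ g′) ∘ h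
  square-paste {g = g} {f} {g′} {f′} {h} {k} {l} top bottom = begin
    l ∘ (f ∘ g)    ≡⟨ sym (assoc g f l) ⟩
    (l ∘ f) ∘ g    ≡⟨ cong (_∘ g) top ⟩
    (f′ ∘ k) ∘ g   ≡⟨ assoc g k f′ ⟩
    f′ ∘ (k ∘ g)   ≡⟨ cong (f′ ∘_) bottom ⟩
    f′ ∘ (g′ ∘ h)  ≡⟨ sym (assoc h g′ f′) ⟩
    (f′ ∘ g′) ∘ h  ∎

module DaggerProperties {o ℓ : Level} (D : DaggerCategory o ℓ) where
  open DaggerCategory D
  open ≡-Reasoning

  †-square : ∀ {A B B′ C′} {f : Hom A B} {g : Hom B C′} {h : Hom A B′} {k : Hom B′ C′} →
             g ∘ f ≡ k ∘ h → f † ∘ g † ≡ h † ∘ k †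
  †-square {f = f} {g} {h} {k} sq = begin
    f † ∘ g †   ≡⟨ sym (†-∘ f g) ⟩
    (g ∘ f) †   ≡⟨ cong _† sq ⟩
    (k ∘ h) †   ≡⟨ †-∘ h k ⟩
    h † ∘ k †   ∎

  †∘-self-adjoint : ∀ {A B} (f : Hom A B) → (f † ∘ f) † ≡ f † ∘ f
  †∘-self-adjoint f = trans (†-∘ f (f †)) (cong (f † ∘_) (†-involutive f))

module FrobeniusProperties {o ℓ : Level} {D : DaggerCategory o ℓ} (F : FrobeniusMonad D) where
  open DaggerCategory D
  open FrobeniusMonad F
  open EM F
  open CategoryProperties cat
  open DaggerProperties D
  open ≡-Reasoning

  T-†-involutive : ∀ {A B} (f : Hom A B) → T₁ (f †) † ≡ T₁ f
  T-†-involutive f = trans (sym (T-† (f †))) (cong T₁ (†-involutive f))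

  T²-†-involutive : ∀ {A B} (f : Hom A B) → T₁ (T₁ (f †)) † ≡ T₁ (T₁ f)
  T²-†-involutive f = trans (sym (T-† (T₁ (f †)))) (cong T₁ (T-†-involutive f))

  μ†-natural : ∀ {A B} (f : Hom A B) → T₁ (T₁ f) ∘ μ A † ≡ μ B † ∘ T₁ f
  μ†-natural {A} {B} f = begin
    T₁ (T₁ f) ∘ μ A †          ≡⟨ cong (_∘ μ A †) (sym (T²-†-involutive f)) ⟩
    T₁ (T₁ (f †)) † ∘ μ A †    ≡⟨ †-square (μ-natural (f †)) ⟩
    μ B † ∘ T₁ (f †) †         ≡⟨ cong (μ B † ∘_) (T-†-involutive f) ⟩
    μ B † ∘ T₁ f               ∎

  ν : ∀ A → Hom A (T₀ (T₀ A))
  ν A = μ A † ∘ η A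

  ν-natural : ∀ {A B} (f : Hom A B) → T₁ (T₁ f) ∘ ν A ≡ ν B ∘ f
  ν-natural f = square-paste (μ†-natural f) (sym (η-natural f))

  free-isFEM : ∀ A → IsFEM (free A)
  free-isFEM A = trans (cong (μ (T₀ A) ∘_) (sym (T-† (μ A)))) (sym (frobenius A))

  action-†-FEM : ∀ X → IsFEM X → action X † ≡ T₁ (action X) ∘ ν (carrier X)
  action-†-FEM (alg A a _ _) fem = begin
    a †                          ≡⟨ sym (identityˡ (a †)) ⟩
    id ∘ a †                     ≡⟨ cong (_∘ a †) (sym (μ-unitˡ A)) ⟩
    (μ A ∘ η (T₀ A)) ∘ a †       ≡⟨ assoc (a †) (η (T₀ A)) (μ A) ⟩
    μ A ∘ (η (T₀ A) ∘ a †)       ≡⟨ cong (μ A ∘_) (η-natural (a †)) ⟩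
    μ A ∘ (T₁ (a †) ∘ η A)       ≡⟨ sym (assoc (η A) (T₁ (a †)) (μ A)) ⟩
    (μ A ∘ T₁ (a †)) ∘ η A       ≡⟨ cong (λ g → (μ A ∘ g) ∘ η A) (T-† a) ⟩
    (μ A ∘ T₁ a †) ∘ η A         ≡⟨ cong (_∘ η A) fem ⟩
    (T₁ a ∘ μ A †) ∘ η A         ≡⟨ assoc (η A) (μ A †) (T₁ a) ⟩
    T₁ a ∘ ν A                   ∎

  T-AlgHom : ∀ {X Y} (f : AlgHom X Y) →
             T₁ (map f) ∘ T₁ (action X) ≡ T₁ (action Y) ∘ T₁ (T₁ (map f))
  T-AlgHom {X} {Y} f = begin
    T₁ (map f) ∘ T₁ (action X)        ≡⟨ sym (T-∘ (action X) (map f)) ⟩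
    T₁ (map f ∘ action X)             ≡⟨ cong T₁ (sym (commutes f)) ⟩
    T₁ (action Y ∘ T₁ (map f))        ≡⟨ T-∘ (T₁ (map f)) (action Y) ⟩
    T₁ (action Y) ∘ T₁ (T₁ (map f))   ∎

  AlgHom-action-† : ∀ {X Y} → IsFEM X → IsFEM Y → (f : AlgHom X Y) →
                    T₁ (map f) ∘ action X † ≡ action Y † ∘ map f
  AlgHom-action-† {X} {Y} femX femY f = begin
    T₁ (map f) ∘ action X †                ≡⟨ cong (T₁ (map f) ∘_) (action-†-FEM X femX) ⟩
    T₁ (map f) ∘ (T₁ (action X) ∘ ν _)     ≡⟨ square-paste (T-AlgHom f) (ν-natural (map f)) ⟩
    (T₁ (action Y) ∘ ν _) ∘ map f          ≡⟨ cong (_∘ map f) (sym (action-†-FEM Y femY)) ⟩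
    action Y † ∘ map f                     ∎

  AlgHom-† : ∀ {X Y} → IsFEM X → IsFEM Y → AlgHom X Y → AlgHom Y X
  AlgHom-† {X} {Y} femX femY f = alghom (map f †) (begin
    action X ∘ T₁ (map f †)          ≡⟨ cong₂ _∘_ (sym (†-involutive (action X))) (T-† (map f)) ⟩
    action X † † ∘ T₁ (map f) †      ≡⟨ †-square (AlgHom-action-† femX femY f) ⟩
    map f † ∘ action Y † †           ≡⟨ cong (map f † ∘_) (†-involutive (action Y)) ⟩
    map f † ∘ action Y               ∎)

  FEM-dagger : DaggerOverU IsFEM
  FEM-dagger = record
    { _‡ = AlgHom-†
    ; ‡-U = λ _ _ _ → refl
    ; ‡-id = λ _ → †-id
    ; ‡-∘ = λ _ _ _ f g gf gf≡g∘f → trans (cong _† gf≡g∘f) (†-∘ (map f) (map g))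
    ; ‡-involutive = λ _ _ f → †-involutive (map f)
    }

  isFEM-if-action-†-AlgHom : ∀ X → μ (carrier X) ∘ T₁ (action X †) ≡ action X † ∘ action X →
                             IsFEM X
  isFEM-if-action-†-AlgHom (alg A a _ _) a†-hom = begin
    μ A ∘ T₁ a †            ≡⟨ cong (μ A ∘_) (sym (T-† a)) ⟩
    μ A ∘ T₁ (a †)          ≡⟨ a†-hom ⟩
    a † ∘ a                 ≡⟨ sym (†∘-self-adjoint a) ⟩
    (a † ∘ a) †             ≡⟨ cong _† (sym a†-hom) ⟩
    (μ A ∘ T₁ (a †)) †      ≡⟨ †-∘ (T₁ (a †)) (μ A) ⟩
    T₁ (a †) † ∘ μ A †      ≡⟨ cong (_∘ μ A †) (T-†-involutive a) ⟩
    T₁ a ∘ μ A †            ∎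

  action-AlgHom : ∀ X → AlgHom (free (carrier X)) X
  action-AlgHom X = alghom (action X) (act-μ X)

  isFEM-if-dagger : ∀ {p} (P : Alg → Set p) → (∀ A → P (free A)) →
                    DaggerOverU P → ∀ X → P X → IsFEM X
  isFEM-if-dagger P P-free dagger X PX = isFEM-if-action-†-AlgHom X a†-AlgHom
    where
      open DaggerOverU dagger
      a‡ : AlgHom X (free (carrier X))
      a‡ = _‡ (P-free (carrier X)) PX (action-AlgHom X)

      a†-AlgHom : μ (carrier X) ∘ T₁ (action X †) ≡ action X † ∘ action X
      a†-AlgHom = subst (λ m → μ (carrier X) ∘ T₁ m ≡ m ∘ action X)
                        (‡-U (P-free (carrier X)) PX (action-AlgHom X)) (commutes a‡)

theorem6p6 : ∀ {o ℓ p : Level} (D : DaggerCategory o ℓ) (F : FrobeniusMonad D) →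
  let open DaggerCategory D
      open EM F
  in ((∀ (A : Obj) → IsFEM (free A)) × DaggerOverU IsFEM)
     × (∀ (P : Alg → Set p) → (∀ (A : Obj) → P (free A)) →
        DaggerOverU P → ∀ (X : Alg) → P X → IsFEM X)
theorem6p6 D F = (free-isFEM , FEM-dagger) , isFEM-if-dagger
  where open FrobeniusProperties F
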